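{- Fix an odd integer $n\geq3$ and let $\overline{ML}(n)$ be the maximal length of a solvable torus board of size $n$. Then $2n-1\leq\overline{ML}(n)\leq 4n$; in particular $\overline{ML}(n)=\Theta(n)$ as $n\to\infty$.
   Context: Let $\mathcal{D}=\{\mathrm{N},\mathrm{NE},\mathrm{E},\mathrm{SE},\mathrm{S},\mathrm{SW},\mathrm{W},\mathrm{NW}\}$, and associate to these the vectors $(-1,0),(-1,1),(0,1),(1,1),(1,0),(1,-1),(0,-1),(-1,-1)$ respectively (first coordinate = row index, increasing downward; second = column index, increasing rightward). For odd $n\geq3$, a torus board of size $n$ is an $n\times n$ matrix $A=(a_{ij})$ with entries in $\mathcal{D}$, with positions regarded as elements of $(\mathbb{Z}/n\mathbb{Z})^2$ (indices $1,\dots,n$ taken mod $n$). The entry $a_{ij}$ with associated vector $(d_1,d_2)$ is directing to every position $(i+t d_1, j+t d_2)$ (mod $n$), $t\geq1$, that is different from $(i,j)$. A move goes from $(i,j)$ to any position to which $a_{ij}$ is directing. The torus board is solvable if some finite sequence of moves leads from $(1,1)$ to $(\frac{n+1}{2},\frac{n+1}{2})$, and its length is the minimal number of moves in such a sequence. -}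

module Defs where

open import Data.Nat using (ℕ; zero; suc; _+_; _*_; _∸_; _≤_)
open import Data.Nat.DivMod using (_mod_)
open import Data.Fin using (Fin; toℕ)
open import Data.Product using (_×_; _,_; ∃-syntax)
open import Relation.Binary.PropositionalEquality using (_≡_)
open import Relation.Nullary using (¬_)

data Dir : Set where
  N NE E SE S SW W NW : Dir

data Δ : Set where
  minus nil plus : Δ

-- Associated vectors (row displacement, column displacement);
-- rows increase downward, columns increase rightward.
vec : Dir → Δ × Δ
vec N  = minus , nil
vec NE = minus , plus
vec E  = nil   , plus
vec SE = plus  , plus
vec S  = plus  , nil
vec SW = plus  , minus
vec W  = nil   , minus
vec NW = minus , minus

-- Torus boards of size n = 2k+1 (positions are Fin n × Fin n,
-- 0-based: paper index i corresponds to Fin element i-1).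
size : ℕ → ℕ
size k = suc (2 * k)

Pos : ℕ → Set
Pos k = Fin (size k) × Fin (size k)

Board : ℕ → Set
Board k = Fin (size k) → Fin (size k) → Dir

shift1 : (k : ℕ) → Δ → Fin (size k) → Fin (size k)
shift1 k minus i = (toℕ i + 2 * k) mod (size k)   -- i - 1 mod n
shift1 k nil   i = i
shift1 k plus  i = (toℕ i + 1) mod (size k)

shift : (k : ℕ) → Δ × Δ → Pos k → Pos k
shift k (d₁ , d₂) (i , j) = shift1 k d₁ i , shift1 k d₂ j

shiftBy : (k : ℕ) → Δ × Δ → ℕ → Pos k → Pos k
shiftBy k d zero    p = p
shiftBy k d (suc t) p = shift k d (shiftBy k d t p)

entry : (k : ℕ) → Board k → Pos k → Dir
entry k A (i , j) = A i j

Move : {k : ℕ} → Board k → Pos k → Pos k → Set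
Move {k} A p q = (∃[ t ] shiftBy k (vec (entry k A p)) (suc t) p ≡ q) × ¬ (q ≡ p)

data Moves (k : ℕ) (A : Board k) : ℕ → Pos k → Pos k → Set where
  done : ∀ {p} → Moves k A 0 p p
  step : ∀ {m p q r} → Move {k} A p q → Moves k A m q r → Moves k A (suc m) p r

-- Start (1,1) and centre ((n+1)/2,(n+1)/2) = (k+1,k+1), 0-based (0,0) and (k,k).
start : (k : ℕ) → Pos k
start k = (0 mod size k) , (0 mod size k)

centre : (k : ℕ) → Pos k
centre k = (k mod size k) , (k mod size k)

HasLength : {k : ℕ} → Board k → ℕ → Set
HasLength {k} A L = Moves k A L (start k) (centre k)
                  × (∀ m → Moves k A m (start k) (centre k) → L ≤ m)

Solvable : {k : ℕ} → Board k → Set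
Solvable {k} A = ∃[ m ] Moves k A m (start k) (centre k)

{-# OPTIONS --safe #-}

-- A move from p runs along one of the four lines through p (its row, its column or
-- one of its two diagonals), chosen by the entry at p, so every source of a move
-- determines one of 4n (axis, line) pairs. If two sources of a minimal solution
-- gave the same pair, the earlier one could move straight to the position following
-- the later one, giving a shorter solution; hence a minimal solution has at most 4n
-- moves.
--
-- For the lower bound give row r the rank 2r mod n and column c the rank
-- 2(n - 1 - c) mod n, and at ranks (x, y) point S when x = y or x > y + 1, and E
-- otherwise. The potential min(2x + 1, 2y + 2) then grows by at most one per move,
-- is at most 1 after the first move (an E move along row 0) and equals 2n - 1 at the
-- centre, while a staircase alternating S and E moves along the rank diagonal
-- reaches the centre in 2n - 1 moves.

module Submission where

open import Defs
open import Data.Nat using (ℕ; zero; suc; _+_; _*_; _∸_; _≤_; _<_; _⊓_; _%_; z≤n; s≤s; NonZero; _≟_; _≤?_)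
open import Data.Nat.Properties
open import Data.Nat.DivMod using (_mod_; m%n<n; m%n%n≡m%n; m<n⇒m%n≡m; [m+kn]%n≡m%n; %-distribˡ-+; %-distribˡ-*; %-remove-+ʳ)
open import Data.Nat.Divisibility using (_∣_; _∣0; ∣-refl; ∣-reflexive; m∣m*n; ∣m⇒∣m*n; ∣n⇒∣m*n)
open import Data.Nat.Tactic.RingSolver using (solve-∀)
open import Data.Fin using (Fin; toℕ; zero; suc; combine; opposite) renaming (_≟_ to _≟ᶠ_)
open import Data.Fin.Properties using (toℕ-injective; toℕ<n; toℕ-fromℕ<; fromℕ<-cong; opposite-prop; opposite-involutive; combine-injective; injective⇒≤)
open import Data.Vec using (Vec; []; _∷_)
open import Data.Vec.Relation.Unary.All using (All; []; _∷_; all?)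
open import Data.Vec.Relation.Unary.AllPairs using ([]; _∷_)
open import Data.Vec.Relation.Unary.Unique.Propositional using (Unique)
open import Data.Vec.Relation.Unary.Unique.Propositional.Properties using (lookup-injective)
open import Data.Product using (_×_; _,_; proj₁; proj₂; ∃-syntax)
open import Data.Product.Properties using (≡-dec)
open import Data.Sum using (_⊎_; inj₁; inj₂)
open import Data.Empty using (⊥-elim)
open import Function using (_∘_)
open import Relation.Nullary using (¬_; Dec; yes; no; ¬?)
open import Relation.Binary.PropositionalEquality using (_≡_; _≢_; refl; sym; trans; cong; cong₂; subst; module ≡-Reasoning)

-- Residues modulo n

module _ {n : ℕ} .{{_ : NonZero n}} where

  toℕ-mod : ∀ a → toℕ (a mod n) ≡ a % n
  toℕ-mod a = toℕ-fromℕ< (m%n<n a n)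

  mod-cong : ∀ {a b} → a % n ≡ b % n → a mod n ≡ b mod n
  mod-cong {a} {b} eq = fromℕ<-cong (a % n) (b % n) eq (m%n<n a n) (m%n<n b n)

  toℕ-mod-self : ∀ (i : Fin n) → toℕ i mod n ≡ i
  toℕ-mod-self i = toℕ-injective (trans (toℕ-mod (toℕ i)) (m<n⇒m%n≡m (toℕ<n i)))

  mod-absorbˡ-+ : ∀ a b → (toℕ (a mod n) + b) mod n ≡ (a + b) mod n
  mod-absorbˡ-+ a b = mod-cong (begin
    (toℕ (a mod n) + b) % n  ≡⟨ cong (λ x → (x + b) % n) (toℕ-mod a) ⟩
    (a % n + b) % n          ≡⟨ %-distribˡ-+ (a % n) b n ⟩
    (a % n % n + b % n) % n  ≡⟨ cong (λ x → (x + b % n) % n) (m%n%n≡m%n a n) ⟩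
    (a % n + b % n) % n      ≡⟨ %-distribˡ-+ a b n ⟨
    (a + b) % n              ∎)
    where open ≡-Reasoning

  %-absorbˡ-* : ∀ a b → (a % n * b) % n ≡ (a * b) % n
  %-absorbˡ-* a b = begin
    (a % n * b) % n            ≡⟨ %-distribˡ-* (a % n) b n ⟩
    (a % n % n * (b % n)) % n  ≡⟨ cong (λ x → (x * (b % n)) % n) (m%n%n≡m%n a n) ⟩
    (a % n * (b % n)) % n      ≡⟨ %-distribˡ-* a b n ⟨
    (a * b) % n                ∎
    where open ≡-Reasoning

  mod-+-multiple : ∀ a {d} → n ∣ d → (a + d) mod n ≡ a mod n
  mod-+-multiple a n∣d = mod-cong (%-remove-+ʳ a n∣d)

-- Shortcuts in walks

module _ {k : ℕ} (A : Board k) {K : ℕ} (label : Pos k → Fin K)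
         (shortcut : ∀ {p q r} → label p ≡ label q → Move {k} A q r → r ≢ p → Move {k} A p r) where

  private
    _≟ₚ_ : ∀ (p q : Pos k) → Dec (p ≡ q)
    _≟ₚ_ = ≡-dec _≟ᶠ_ _≟ᶠ_

  labels : ∀ {m p q} → Moves k A m p q → Vec (Fin K) m
  labels done                = []
  labels (step {p = p} _ w) = label p ∷ labels w

  shortcut-from : ∀ {m x y q} (w : Moves k A m y q) → ¬ All (label x ≢_) (labels w) →
                  ∃[ m′ ] m′ ≤ m × Moves k A m′ x q
  shortcut-from done occurs = ⊥-elim (occurs [])
  shortcut-from {x = x} (step {p = y} {q = y′} mv w) occurs with label x ≟ᶠ label y
  ... | no x≉y =
    let (m′ , m′≤m , w′) = shortcut-from w (occurs ∘ (x≉y ∷_)) in m′ , m≤n⇒m≤1+n m′≤m , w′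
  ... | yes x≈y with y′ ≟ₚ x
  ...   | yes refl = _ , n≤1+n _ , w
  ...   | no y′≢x  = _ , ≤-refl , step (shortcut x≈y mv y′≢x) w

  shorten-or-unique : ∀ {m p q} (w : Moves k A m p q) →
                      (∃[ m′ ] m′ < m × Moves k A m′ p q) ⊎ Unique (labels w)
  shorten-or-unique done = inj₂ []
  shorten-or-unique {p = p} (step mv w) with shorten-or-unique w
  ... | inj₁ (m′ , m′<m , w′) = inj₁ (suc m′ , s≤s m′<m , step mv w′)
  ... | inj₂ unique with all? (λ l → ¬? (label p ≟ᶠ l)) (labels w)
  ...   | yes fresh = inj₂ (fresh ∷ unique)
  ...   | no occurs = let (m′ , m′≤m , w′) = shortcut-from w occurs in inj₁ (m′ , s≤s m′≤m , w′)

  minimal-length≤ : ∀ {m p q} (w : Moves k A m p q) →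
                    (∀ m′ → Moves k A m′ p q → m ≤ m′) → m ≤ K
  minimal-length≤ w minimal with shorten-or-unique w
  ... | inj₁ (m′ , m′<m , w′) = ⊥-elim (<⇒≱ m′<m (minimal m′ w′))
  ... | inj₂ unique = injective⇒≤ (λ {i} {j} → lookup-injective unique i j)

potential-walk-bound : ∀ {k} {A : Board k} (f : Pos k → ℕ) →
                       (∀ {p q} → Move {k} A p q → f q ≤ suc (f p)) →
                       ∀ {m p q} → Moves k A m p q → f q ≤ f p + m
potential-walk-bound f f-move {p = p} done = ≤-reflexive (sym (+-identityʳ (f p)))
potential-walk-bound f f-move {p = p} {r} (step {m = m} {q = q} mv w) = begin
  f r            ≤⟨ potential-walk-bound f f-move w ⟩
  f q + m        ≤⟨ +-monoˡ-≤ m (f-move mv) ⟩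
  suc (f p) + m  ≡⟨ +-suc (f p) m ⟨
  f p + suc m    ∎
  where open ≤-Reasoning

-- Lines of the torus

module Torus (k : ℕ) where

  n : ℕ
  n = size k

  offset : Δ → ℕ
  offset minus = 2 * k
  offset nil   = 0
  offset plus  = 1

  advance : Δ → ℕ → Fin n → Fin n
  advance δ s i = (toℕ i + offset δ * s) mod n

  shift1-mod : ∀ δ i → shift1 k δ i ≡ (toℕ i + offset δ) mod n
  shift1-mod minus i = refl
  shift1-mod nil   i = sym (trans (cong (_mod n) (+-identityʳ (toℕ i))) (toℕ-mod-self i))
  shift1-mod plus  i = refl

  advance-multiple : ∀ δ s i → n ∣ offset δ * s → advance δ s i ≡ i
  advance-multiple δ s i n∣ = trans (mod-+-multiple (toℕ i) n∣) (toℕ-mod-self i)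

  advance-suc : ∀ δ s i → shift1 k δ (advance δ s i) ≡ advance δ (suc s) i
  advance-suc δ s i = begin
    shift1 k δ (advance δ s i)                  ≡⟨ shift1-mod δ (advance δ s i) ⟩
    (toℕ (advance δ s i) + offset δ) mod n      ≡⟨ mod-absorbˡ-+ (toℕ i + offset δ * s) (offset δ) ⟩
    (toℕ i + offset δ * s + offset δ) mod n     ≡⟨ cong (_mod n) (identity (toℕ i) (offset δ) s) ⟩
    advance δ (suc s) i                         ∎
    where
    open ≡-Reasoning
    identity : ∀ a b s → a + b * s + b ≡ a + b * suc s
    identity = solve-∀

  shiftBy-advance : ∀ δ₁ δ₂ s i j → shiftBy k (δ₁ , δ₂) s (i , j) ≡ (advance δ₁ s i , advance δ₂ s j)
  shiftBy-advance δ₁ δ₂ zero i j =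
    sym (cong₂ _,_ (advance-multiple δ₁ 0 i (∣n⇒∣m*n (offset δ₁) (n ∣0)))
                   (advance-multiple δ₂ 0 j (∣n⇒∣m*n (offset δ₂) (n ∣0))))
  shiftBy-advance δ₁ δ₂ (suc s) i j =
    trans (cong (shift k (δ₁ , δ₂)) (shiftBy-advance δ₁ δ₂ s i j))
          (cong₂ _,_ (advance-suc δ₁ s i) (advance-suc δ₂ s j))

  shiftBy-+ : ∀ v a b p → shiftBy k v (a + b) p ≡ shiftBy k v a (shiftBy k v b p)
  shiftBy-+ v zero    b p = refl
  shiftBy-+ v (suc a) b p = cong (shift k v) (shiftBy-+ v a b p)

  shiftBy-period : ∀ v t p → shiftBy k v (n * t) p ≡ p
  shiftBy-period (δ₁ , δ₂) t (i , j) =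
    trans (shiftBy-advance δ₁ δ₂ (n * t) i j)
          (cong₂ _,_ (advance-multiple δ₁ (n * t) i (∣n⇒∣m*n (offset δ₁) (m∣m*n t)))
                     (advance-multiple δ₂ (n * t) j (∣n⇒∣m*n (offset δ₂) (m∣m*n t))))

  flip : Δ → Δ
  flip minus = plus
  flip nil   = nil
  flip plus  = minus

  reverse : Δ × Δ → Δ × Δ
  reverse (δ₁ , δ₂) = flip δ₁ , flip δ₂

  reverse-involutive : ∀ v → reverse (reverse v) ≡ v
  reverse-involutive (δ₁ , δ₂) = cong₂ _,_ (flip-involutive δ₁) (flip-involutive δ₂)
    where
    flip-involutive : ∀ δ → flip (flip δ) ≡ δ
    flip-involutive minus = refl
    flip-involutive nil   = refl
    flip-involutive plus  = refl

  offset-flip : ∀ δ → n ∣ offset (flip δ) + offset δ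
  offset-flip minus = ∣-refl
  offset-flip nil   = n ∣0
  offset-flip plus  = ∣-reflexive (+-comm 1 (2 * k))

  advance-flip : ∀ δ s i → advance δ s (advance (flip δ) s i) ≡ i
  advance-flip δ s i = begin
    advance δ s (advance (flip δ) s i)
      ≡⟨ mod-absorbˡ-+ (toℕ i + offset (flip δ) * s) (offset δ * s) ⟩
    (toℕ i + offset (flip δ) * s + offset δ * s) mod n
      ≡⟨ cong (_mod n) (identity (toℕ i) (offset (flip δ)) (offset δ) s) ⟩
    (toℕ i + (offset (flip δ) + offset δ) * s) mod n
      ≡⟨ mod-+-multiple (toℕ i) (∣m⇒∣m*n s (offset-flip δ)) ⟩
    toℕ i mod n
      ≡⟨ toℕ-mod-self i ⟩
    i ∎
    where
    open ≡-Reasoning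
    identity : ∀ a b c s → a + b * s + c * s ≡ a + (b + c) * s
    identity = solve-∀

  shiftBy-reverse : ∀ v s p → shiftBy k v s (shiftBy k (reverse v) s p) ≡ p
  shiftBy-reverse (δ₁ , δ₂) s (i , j) = begin
    shiftBy k (δ₁ , δ₂) s (shiftBy k (flip δ₁ , flip δ₂) s (i , j))
      ≡⟨ cong (shiftBy k (δ₁ , δ₂) s) (shiftBy-advance (flip δ₁) (flip δ₂) s i j) ⟩
    shiftBy k (δ₁ , δ₂) s (advance (flip δ₁) s i , advance (flip δ₂) s j)
      ≡⟨ shiftBy-advance δ₁ δ₂ s _ _ ⟩
    (advance δ₁ s (advance (flip δ₁) s i) , advance δ₂ s (advance (flip δ₂) s j))
      ≡⟨ cong₂ _,_ (advance-flip δ₁ s i) (advance-flip δ₂ s j) ⟩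
    (i , j) ∎
    where open ≡-Reasoning

  stepsTo : Fin n → Fin n → ℕ
  stepsTo x y = n ∸ toℕ x + toℕ y

  advance-stepsTo : ∀ x y → advance plus (stepsTo x y) x ≡ y
  advance-stepsTo x y = begin
    (toℕ x + 1 * (n ∸ toℕ x + toℕ y)) mod n   ≡⟨ cong (λ a → (toℕ x + a) mod n) (*-identityˡ _) ⟩
    (toℕ x + (n ∸ toℕ x + toℕ y)) mod n       ≡⟨ cong (_mod n) (+-assoc (toℕ x) _ _) ⟨
    (toℕ x + (n ∸ toℕ x) + toℕ y) mod n       ≡⟨ cong (λ a → (a + toℕ y) mod n) (m+[n∸m]≡n (<⇒≤ (toℕ<n x))) ⟩
    (n + toℕ y) mod n                         ≡⟨ cong (_mod n) (+-comm n (toℕ y)) ⟩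
    (toℕ y + n) mod n                         ≡⟨ mod-+-multiple (toℕ y) ∣-refl ⟩
    toℕ y mod n                               ≡⟨ toℕ-mod-self y ⟩
    y                                         ∎
    where open ≡-Reasoning

  Along : Δ × Δ → Pos k → Pos k → Set
  Along v p q = ∃[ s ] shiftBy k v s p ≡ q

  Along-trans : ∀ {v p q r} → Along v p q → Along v q r → Along v p r
  Along-trans {v} {p} (s , refl) (s′ , refl) = s′ + s , shiftBy-+ v s′ s p

  Along-sym : ∀ {v p q} → Along v p q → Along v q p
  Along-sym {v} {p} (s , refl) = 2 * k * s , (begin
    shiftBy k v (2 * k * s) (shiftBy k v s p)  ≡⟨ shiftBy-+ v (2 * k * s) s p ⟨
    shiftBy k v (2 * k * s + s) p              ≡⟨ cong (λ t → shiftBy k v t p) (+-comm (2 * k * s) s) ⟩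
    shiftBy k v (n * s) p                      ≡⟨ shiftBy-period v s p ⟩
    p                                          ∎)
    where open ≡-Reasoning

  Along-reverse : ∀ {v p q} → Along (reverse v) p q → Along v p q
  Along-reverse {v} {p} (s , refl) = Along-sym (s , shiftBy-reverse v s p)

  Along-unreverse : ∀ {v p q} → Along v p q → Along (reverse v) p q
  Along-unreverse {v} {p} {q} along =
    Along-reverse (subst (λ w → Along w p q) (sym (reverse-involutive v)) along)

  Along-row : ∀ {i j j′} → Along (nil , plus) (i , j) (i , j′)
  Along-row {i} {j} {j′} = stepsTo j j′ ,
    trans (shiftBy-advance nil plus (stepsTo j j′) i j)
          (cong₂ _,_ (advance-multiple nil (stepsTo j j′) i (n ∣0)) (advance-stepsTo j j′))

  Along-column : ∀ {i i′ j} → Along (plus , nil) (i , j) (i′ , j)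
  Along-column {i} {i′} {j} = stepsTo i i′ ,
    trans (shiftBy-advance plus nil (stepsTo i i′) i j)
          (cong₂ _,_ (advance-stepsTo i i′) (advance-multiple nil (stepsTo i i′) j (n ∣0)))

  Along-keeps-row : ∀ {δ i j q} → Along (nil , δ) (i , j) q → proj₁ q ≡ i
  Along-keeps-row {δ} {i} {j} (s , refl) =
    trans (cong proj₁ (shiftBy-advance nil δ s i j)) (advance-multiple nil s i (n ∣0))

  Along-keeps-column : ∀ {δ i j q} → Along (δ , nil) (i , j) q → proj₂ q ≡ j
  Along-keeps-column {δ} {i} {j} (s , refl) =
    trans (cong proj₂ (shiftBy-advance δ nil s i j)) (advance-multiple nil s j (n ∣0))

  Axis : Set
  Axis = Fin 4

  slope : Fin 3 → Δ
  slope zero             = minus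
  slope (suc zero)       = nil
  slope (suc (suc zero)) = plus

  axis : Axis → Δ × Δ
  axis zero    = nil , plus
  axis (suc s) = plus , slope s

  axisOf : Dir → Axis
  axisOf E  = zero
  axisOf W  = zero
  axisOf SW = suc zero
  axisOf NE = suc zero
  axisOf S  = suc (suc zero)
  axisOf N  = suc (suc zero)
  axisOf SE = suc (suc (suc zero))
  axisOf NW = suc (suc (suc zero))

  vec-axisOf : ∀ d → vec d ≡ axis (axisOf d) ⊎ vec d ≡ reverse (axis (axisOf d))
  vec-axisOf N  = inj₂ refl
  vec-axisOf NE = inj₂ refl
  vec-axisOf E  = inj₁ refl
  vec-axisOf SE = inj₁ refl
  vec-axisOf S  = inj₁ refl
  vec-axisOf SW = inj₁ refl
  vec-axisOf W  = inj₂ refl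
  vec-axisOf NW = inj₂ refl

  Along-vec⇒axis : ∀ d {p q} → Along (vec d) p q → Along (axis (axisOf d)) p q
  Along-vec⇒axis d {p} {q} along with vec-axisOf d
  ... | inj₁ eq = subst (λ v → Along v p q) eq along
  ... | inj₂ eq = Along-reverse (subst (λ v → Along v p q) eq along)

  Along-axis⇒vec : ∀ d {p q} → Along (axis (axisOf d)) p q → Along (vec d) p q
  Along-axis⇒vec d {p} {q} along with vec-axisOf d
  ... | inj₁ eq = subst (λ v → Along v p q) (sym eq) along
  ... | inj₂ eq = subst (λ v → Along v p q) (sym eq) (Along-unreverse along)

  -- Along each axis the pivot coordinate advances by plus, so every line of the axis
  -- meets pivot 0 in exactly one point, its anchor; the transversal coordinate of the
  -- anchor names the line.
  pivot : Axis → Pos k → Fin n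
  pivot zero    (i , j) = j
  pivot (suc _) (i , j) = i

  transversal : Axis → Pos k → Fin n
  transversal zero    (i , j) = i
  transversal (suc _) (i , j) = j

  pivot-transversal-injective : ∀ a {p q} → pivot a p ≡ pivot a q → transversal a p ≡ transversal a q →
                                p ≡ q
  pivot-transversal-injective zero    eq₁ eq₂ = cong₂ _,_ eq₂ eq₁
  pivot-transversal-injective (suc _) eq₁ eq₂ = cong₂ _,_ eq₁ eq₂

  anchor : Axis → Pos k → Pos k
  anchor a p = shiftBy k (axis a) (stepsTo (pivot a p) zero) p

  lineId : Axis → Pos k → Fin n
  lineId a p = transversal a (anchor a p)

  pivot-anchor : ∀ a p → pivot a (anchor a p) ≡ zero
  pivot-anchor zero    (i , j) =
    trans (cong proj₂ (shiftBy-advance nil plus _ i j)) (advance-stepsTo j zero)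
  pivot-anchor (suc s) (i , j) =
    trans (cong proj₁ (shiftBy-advance plus (slope s) _ i j)) (advance-stepsTo i zero)

  Along-anchor : ∀ a p → Along (axis a) p (anchor a p)
  Along-anchor a p = _ , refl

  lineId⇒Along : ∀ a {p q} → lineId a p ≡ lineId a q → Along (axis a) p q
  lineId⇒Along a {p} {q} same =
    Along-trans (Along-anchor a p)
                (subst (λ x → Along (axis a) x q) (sym same-anchor) (Along-sym (Along-anchor a q)))
    where
    same-anchor : anchor a p ≡ anchor a q
    same-anchor = pivot-transversal-injective a (trans (pivot-anchor a p) (sym (pivot-anchor a q))) same

  Move⇒Along : ∀ (A : Board k) {p q} → Move {k} A p q → Along (vec (entry k A p)) p q
  Move⇒Along A ((t , e) , _) = suc t , e

  Along⇒Move : ∀ (A : Board k) {p q} → Along (vec (entry k A p)) p q → q ≢ p → Move {k} A p q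
  Along⇒Move A (zero  , e) q≢p = ⊥-elim (q≢p (sym e))
  Along⇒Move A (suc t , e) q≢p = (t , e) , q≢p

  move-along-row : ∀ (A : Board k) {i j j′} → entry k A (i , j) ≡ E → j′ ≢ j →
                   Move {k} A (i , j) (i , j′)
  move-along-row A {i} {j} {j′} isE j′≢j =
    Along⇒Move A (subst (λ d → Along (vec d) (i , j) (i , j′)) (sym isE) Along-row) (j′≢j ∘ cong proj₂)

  move-along-column : ∀ (A : Board k) {i i′ j} → entry k A (i , j) ≡ S → i′ ≢ i →
                      Move {k} A (i , j) (i′ , j)
  move-along-column A {i} {i′} {j} isS i′≢i =
    Along⇒Move A (subst (λ d → Along (vec d) (i , j) (i′ , j)) (sym isS) Along-column) (i′≢i ∘ cong proj₁)

  label : Board k → Pos k → Fin (4 * n)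
  label A p = combine (axisOf (entry k A p)) (lineId (axisOf (entry k A p)) p)

  Move-shortcut : ∀ (A : Board k) {p q r} → label A p ≡ label A q →
                  Move {k} A q r → r ≢ p → Move {k} A p r
  Move-shortcut A {p} {q} {r} same q→r r≢p =
    Along⇒Move A (Along-axis⇒vec (entry k A p) (Along-trans p⇝q q⇝r)) r≢p
    where
    a  = axisOf (entry k A p)
    a′ = axisOf (entry k A q)
    same-axis : a ≡ a′
    same-axis = proj₁ (combine-injective a (lineId a p) a′ (lineId a′ q) same)
    p⇝q : Along (axis a) p q
    p⇝q = lineId⇒Along a (trans (proj₂ (combine-injective a (lineId a p) a′ (lineId a′ q) same))
                                (cong (λ b → lineId b q) (sym same-axis)))
    q⇝r : Along (axis a) q r
    q⇝r = subst (λ b → Along (axis b) q r) (sym same-axis) (Along-vec⇒axis (entry k A q) (Move⇒Along A q→r))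

-- The staircase board

module Staircase (k : ℕ) (k≥1 : 1 ≤ k) where

  open Torus k

  rowRank : Fin n → ℕ
  rowRank r = (toℕ r * 2) % n

  colRank : Fin n → ℕ
  colRank c = rowRank (opposite c)

  rowOfRank : ℕ → Fin n
  rowOfRank x = (x * suc k) mod n

  colOfRank : ℕ → Fin n
  colOfRank x = opposite (rowOfRank x)

  -- rowOfRank inverts rowRank since (suc k) * 2 = n + 1.
  rowRank-rowOfRank : ∀ {x} → x < n → rowRank (rowOfRank x) ≡ x
  rowRank-rowOfRank {x} x<n = begin
    (toℕ ((x * suc k) mod n) * 2) % n  ≡⟨ cong (λ y → (y * 2) % n) (toℕ-mod (x * suc k)) ⟩
    ((x * suc k) % n * 2) % n          ≡⟨ %-absorbˡ-* (x * suc k) 2 ⟩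
    (x * suc k * 2) % n                ≡⟨ cong (_% n) (identity x k) ⟩
    (x + x * n) % n                    ≡⟨ [m+kn]%n≡m%n x x n ⟩
    x % n                              ≡⟨ m<n⇒m%n≡m x<n ⟩
    x                                  ∎
    where
    open ≡-Reasoning
    identity : ∀ x k → x * suc k * 2 ≡ x + x * suc (2 * k)
    identity = solve-∀

  rowOfRank-rowRank : ∀ r → rowOfRank (rowRank r) ≡ r
  rowOfRank-rowRank r = trans (mod-cong {a = (toℕ r * 2) % n * suc k} {b = toℕ r} (begin
    ((toℕ r * 2) % n * suc k) % n  ≡⟨ %-absorbˡ-* (toℕ r * 2) (suc k) ⟩
    (toℕ r * 2 * suc k) % n        ≡⟨ cong (_% n) (identity (toℕ r) k) ⟩
    (toℕ r + toℕ r * n) % n        ≡⟨ [m+kn]%n≡m%n (toℕ r) (toℕ r) n ⟩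
    toℕ r % n                      ∎)) (toℕ-mod-self r)
    where
    open ≡-Reasoning
    identity : ∀ x k → x * 2 * suc k ≡ x + x * suc (2 * k)
    identity = solve-∀

  colRank-colOfRank : ∀ {x} → x < n → colRank (colOfRank x) ≡ x
  colRank-colOfRank {x} x<n = trans (cong rowRank (opposite-involutive (rowOfRank x))) (rowRank-rowOfRank x<n)

  rowOfRank-injective : ∀ {x y} → x < n → y < n → rowOfRank x ≡ rowOfRank y → x ≡ y
  rowOfRank-injective x<n y<n eq =
    trans (sym (rowRank-rowOfRank x<n)) (trans (cong rowRank eq) (rowRank-rowOfRank y<n))

  colOfRank-injective : ∀ {x y} → x < n → y < n → colOfRank x ≡ colOfRank y → x ≡ y
  colOfRank-injective x<n y<n eq =
    trans (sym (colRank-colOfRank x<n)) (trans (cong colRank eq) (colRank-colOfRank y<n))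

  rule : ℕ → ℕ → Dir
  rule x y with x ≟ y
  ... | yes _ = S
  ... | no  _ with x ≤? suc y
  ...   | yes _ = E
  ...   | no  _ = S

  rule-diagonal : ∀ x → rule x x ≡ S
  rule-diagonal x with x ≟ x
  ... | yes _  = refl
  ... | no x≢x = ⊥-elim (x≢x refl)

  rule-below : ∀ {x y} → x ≢ y → x ≤ suc y → rule x y ≡ E
  rule-below {x} {y} x≢y x≤1+y with x ≟ y
  ... | yes x≡y = ⊥-elim (x≢y x≡y)
  ... | no  _ with x ≤? suc y
  ...   | yes _     = refl
  ...   | no  x≰1+y = ⊥-elim (x≰1+y x≤1+y)

  board : Board k
  board r c = rule (rowRank r) (colRank c)

  weight : ℕ → ℕ → ℕ
  weight x y = suc (2 * x) ⊓ suc (suc (2 * y))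

  potential : Pos k → ℕ
  potential (r , c) = weight (rowRank r) (colRank c)

  -- E moves keep the row rank x and S moves keep the column rank y, so these bounds
  -- control the potential after a move.
  rule-weight : ∀ x y → (rule x y ≡ E × suc (2 * x) ≤ suc (weight x y))
                      ⊎ (rule x y ≡ S × suc (suc (2 * y)) ≤ suc (weight x y))
  rule-weight x y with x ≟ y
  ... | yes refl = inj₂ (refl , ⊓-glb (≤-refl {suc (suc (2 * x))}) (n≤1+n (suc (suc (2 * x)))))
  ... | no  _ with x ≤? suc y
  ...   | yes x≤1+y = inj₁ (refl , ⊓-glb (n≤1+n (suc (2 * x)))
                                           (s≤s (≤-trans (*-monoʳ-≤ 2 x≤1+y) (≤-reflexive (*-suc 2 y)))))
  ...   | no  x≰1+y = inj₂ (refl , ⊓-glb (s≤s (s≤s (*-monoʳ-≤ 2 y≤x))) (n≤1+n (suc (suc (2 * y)))))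
    where
    y≤x : y ≤ x
    y≤x = ≤-trans (n≤1+n y) (≤-trans (n≤1+n (suc y)) (≰⇒> x≰1+y))

  potential-move : ∀ {p q} → Move {k} board p q → potential q ≤ suc (potential p)
  potential-move {r , c} {r′ , c′} mv with rule-weight (rowRank r) (colRank c)
  ... | inj₁ (isE , bound) =
    ≤-trans (m⊓n≤m _ _) (subst (λ x → suc (2 * rowRank x) ≤ _) (sym same-row) bound)
    where
    same-row : r′ ≡ r
    same-row = Along-keeps-row (subst (λ d → Along (vec d) (r , c) (r′ , c′)) isE (Move⇒Along board mv))
  ... | inj₂ (isS , bound) =
    ≤-trans (m⊓n≤n _ _) (subst (λ x → suc (suc (2 * colRank x)) ≤ _) (sym same-column) bound)
    where
    same-column : c′ ≡ c
    same-column = Along-keeps-column (subst (λ d → Along (vec d) (r , c) (r′ , c′)) isS (Move⇒Along board mv))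

  2k≢0 : 2 * k ≢ 0
  2k≢0 eq = <⇒≢ (≤-trans k≥1 (m≤m+n k (k + 0))) (sym eq)

  opposite-zero≢zero : opposite zero ≢ zero
  opposite-zero≢zero eq = 2k≢0 (trans (sym (opposite-prop {n} zero)) (cong toℕ eq))

  colRank-zero≢0 : colRank zero ≢ 0
  colRank-zero≢0 eq = opposite-zero≢zero (begin
    opposite zero              ≡⟨ rowOfRank-rowRank (opposite zero) ⟨
    rowOfRank (colRank zero)   ≡⟨ cong rowOfRank eq ⟩
    zero                       ∎)
    where open ≡-Reasoning

  board-start : board zero zero ≡ E
  board-start = rule-below {y = colRank zero} (colRank-zero≢0 ∘ sym) z≤n

  toℕ-centre : toℕ (k mod n) ≡ k
  toℕ-centre = trans (toℕ-mod k) (m<n⇒m%n≡m (s≤s (m≤m+n k (k + 0))))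

  centre≢start : centre k ≢ start k
  centre≢start eq = <⇒≢ k≥1 (sym (trans (sym toℕ-centre) (cong (toℕ ∘ proj₁) eq)))

  opposite-centre : opposite (k mod n) ≡ k mod n
  opposite-centre = toℕ-injective (begin
    toℕ (opposite (k mod n))  ≡⟨ opposite-prop (k mod n) ⟩
    2 * k ∸ toℕ (k mod n)     ≡⟨ cong (2 * k ∸_) toℕ-centre ⟩
    k + (k + 0) ∸ k           ≡⟨ m+n∸m≡n k (k + 0) ⟩
    k + 0                     ≡⟨ +-identityʳ k ⟩
    k                         ≡⟨ toℕ-centre ⟨
    toℕ (k mod n)             ∎)
    where open ≡-Reasoning

  rowOfRank-2k : rowOfRank (2 * k) ≡ k mod n
  rowOfRank-2k = mod-cong {a = 2 * k * suc k} {b = k}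
    (trans (cong (_% n) (identity k)) ([m+kn]%n≡m%n k k n))
    where
    identity : ∀ k → 2 * k * suc k ≡ k + k * suc (2 * k)
    identity = solve-∀

  diagonal : ℕ → Pos k
  diagonal x = rowOfRank x , colOfRank x

  diagonal-2k : diagonal (2 * k) ≡ centre k
  diagonal-2k = cong₂ _,_ rowOfRank-2k (trans (cong opposite rowOfRank-2k) opposite-centre)

  rowRank-centre : rowRank (k mod n) ≡ 2 * k
  rowRank-centre = trans (cong rowRank (sym rowOfRank-2k)) (rowRank-rowOfRank ≤-refl)

  2n∸1≡1+4k : 2 * n ∸ 1 ≡ suc (2 * (2 * k))
  2n∸1≡1+4k = identity k
    where
    identity : ∀ k → 2 * k + (suc (2 * k) + 0) ≡ suc (2 * (2 * k))
    identity = solve-∀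

  potential-centre : potential (centre k) ≡ 2 * n ∸ 1
  potential-centre = begin
    weight (rowRank (k mod n)) (rowRank (opposite (k mod n)))
      ≡⟨ cong (λ c → weight (rowRank (k mod n)) (rowRank c)) opposite-centre ⟩
    weight (rowRank (k mod n)) (rowRank (k mod n))
      ≡⟨ cong (λ x → weight x x) rowRank-centre ⟩
    weight (2 * k) (2 * k)
      ≡⟨ m≤n⇒m⊓n≡m (n≤1+n (suc (2 * (2 * k)))) ⟩
    suc (2 * (2 * k))
      ≡⟨ 2n∸1≡1+4k ⟨
    2 * n ∸ 1 ∎
    where open ≡-Reasoning

  staircase : ∀ j x → x + j ≡ 2 * k → Moves k board (2 * j) (diagonal x) (centre k)
  staircase zero x x+0≡2k =
    subst (λ p → Moves k board 0 p (centre k)) (sym (trans (cong diagonal x≡2k) diagonal-2k)) done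
    where
    x≡2k : x ≡ 2 * k
    x≡2k = trans (sym (+-identityʳ x)) x+0≡2k
  staircase (suc j) x x+1+j≡2k =
    subst (λ m → Moves k board m (diagonal x) (centre k)) (sym (*-suc 2 j))
      (step down (step right (staircase j (suc x) (trans (sym (+-suc x j)) x+1+j≡2k))))
    where
    1+x<n : suc x < n
    1+x<n = s≤s (≤-trans (s≤s (m≤m+n x j)) (≤-reflexive (trans (sym (+-suc x j)) x+1+j≡2k)))
    x<n : x < n
    x<n = <⇒≤ 1+x<n
    down : Move {k} board (diagonal x) (rowOfRank (suc x) , colOfRank x)
    down = move-along-column board
      (trans (cong₂ rule (rowRank-rowOfRank x<n) (colRank-colOfRank x<n)) (rule-diagonal x))
      (1+n≢n ∘ rowOfRank-injective 1+x<n x<n)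
    right : Move {k} board (rowOfRank (suc x) , colOfRank x) (diagonal (suc x))
    right = move-along-row board
      (trans (cong₂ rule (rowRank-rowOfRank 1+x<n) (colRank-colOfRank x<n)) (rule-below {y = x} 1+n≢n ≤-refl))
      (1+n≢n ∘ colOfRank-injective 1+x<n x<n)

  optimal-walk : Moves k board (2 * n ∸ 1) (start k) (centre k)
  optimal-walk = subst (λ m → Moves k board m (start k) (centre k)) (sym 2n∸1≡1+4k)
    (step (move-along-row board board-start opposite-zero≢zero) (staircase (2 * k) 0 refl))

  potential-after-start : ∀ {q} → Move {k} board (start k) q → potential q ≤ 1
  potential-after-start {r , c} mv = ≤-trans (m⊓n≤m _ _) (≤-reflexive (cong (λ x → suc (2 * rowRank x)) row-zero))
    where
    row-zero : r ≡ zero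
    row-zero = Along-keeps-row (subst (λ d → Along (vec d) (start k) (r , c)) board-start (Move⇒Along board mv))

  potential≤length : ∀ {m q} → Moves k board m (start k) q → q ≢ start k → potential q ≤ m
  potential≤length done q≢start = ⊥-elim (q≢start refl)
  potential≤length {q = q} (step {m = m} {q = q₁} mv w) _ = begin
    potential q       ≤⟨ potential-walk-bound potential potential-move w ⟩
    potential q₁ + m  ≤⟨ +-monoˡ-≤ m (potential-after-start mv) ⟩
    suc m             ∎
    where open ≤-Reasoning

  board-hasLength : HasLength {k} board (2 * n ∸ 1)
  board-hasLength = optimal-walk , λ m w → subst (_≤ m) potential-centre (potential≤length w centre≢start)

proposition6p1 : (k : ℕ) → 1 ≤ k →
    (∃[ A ] ∃[ L ] (HasLength {k} A L × 2 * size k ∸ 1 ≤ L))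
    × (∀ (A : Board k) (L : ℕ) → HasLength {k} A L → L ≤ 4 * size k)
proposition6p1 k k≥1 =
  (board , 2 * size k ∸ 1 , board-hasLength , ≤-refl) ,
  λ A L (w , minimal) → minimal-length≤ A (label A) (Move-shortcut A) w minimal
  where
  open Torus k
  open Staircase k k≥1
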